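{- Let $S\subseteq[n]$, $a,b\in S$ (possibly $a=b$), and $c\in[n]\setminus S$. Then for all $r>1$, $$\partial_a h_r(S)=\partial_b h_r(S)+(x_c-x_b)\,\partial_b h_{r-1}(S\cup\{c\})-(x_c-x_a)\,\partial_a h_{r-1}(S\cup\{c\}).$$
   Context: $h_r(S)$ denotes the complete homogeneous symmetric polynomial of degree $r$ in the variables $\{x_k:k\in S\}$, and $\partial_a=\partial/\partial x_a$. -}

module Defs where

open import Data.Nat as ℕ using (ℕ; zero; suc)
open import Data.Integer as ℤ using (ℤ; +_)
open import Data.Bool using (Bool; true; false; _∧_; _∨_; if_then_else_)
open import Data.Fin using (Fin)
open import Data.Fin.Subset using (Subset)
open import Data.Vec using (Vec; []; _∷_; lookup; replicate; _[_]%=_; _[_]≔_)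
import Data.Vec as Vec
open import Data.Vec.Properties using (≡-dec)
open import Data.List using (List; []; _∷_; map; concatMap; upTo; foldr)
open import Data.Product using (_×_; _,_)
open import Relation.Nullary.Decidable using (⌊_⌋)
open import Relation.Binary.PropositionalEquality using (_≡_)

-- Multivariate formal polynomials in x_0..x_{n-1} over ℤ, represented by
-- their coefficient function on exponent vectors α ∈ ℕ^n.
Poly : ℕ → Set
Poly n = Vec ℕ n → ℤ

infix 4 _≈P_
_≈P_ : ∀ {n} → Poly n → Poly n → Set
p ≈P q = ∀ α → p α ≡ q α

infixl 6 _+P_ _-P_
infixl 7 _*P_

_+P_ : ∀ {n} → Poly n → Poly n → Poly n
(p +P q) α = p α ℤ.+ q α

_-P_ : ∀ {n} → Poly n → Poly n → Poly n
(p -P q) α = p α ℤ.- q α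

splits : ∀ {n} → Vec ℕ n → List (Vec ℕ n × Vec ℕ n)
splits [] = ([] , []) ∷ []
splits (k ∷ α) =
  concatMap (λ i → map (λ { (β , γ) → (i ∷ β , (k ℕ.∸ i) ∷ γ) }) (splits α))
            (upTo (suc k))

_*P_ : ∀ {n} → Poly n → Poly n → Poly n
(p *P q) α = foldr (λ { (β , γ) acc → p β ℤ.* q γ ℤ.+ acc }) (+ 0) (splits α)

var : ∀ {n} → Fin n → Poly n
var c α = if ⌊ ≡-dec ℕ._≟_ α (replicate _ 0 [ c ]≔ 1) ⌋ then + 1 else + 0

∂ : ∀ {n} → Fin n → Poly n → Poly n
∂ a p α = + suc (lookup α a) ℤ.* p (α [ a ]%= suc)

suppIn : ∀ {n} → Vec ℕ n → Subset n → Bool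
suppIn [] [] = true
suppIn (k ∷ α) (s ∷ S) = (s ∨ ⌊ k ℕ.≟ 0 ⌋) ∧ suppIn α S

h : ∀ {n} → ℕ → Subset n → Poly n
h r S α = if ⌊ Vec.sum α ℕ.≟ r ⌋ ∧ suppIn α S then + 1 else + 0

{-# OPTIONS --safe #-}
-- Coefficientwise one checks, for a ∈ S and c ∉ S, the identity
--   ∂_a h_{r+1}(S) + (x_c − x_a) ∂_a h_r(S ∪ {c}) = h_r(S ∪ {c}):
-- at x^α, x_a ∂_a contributes α_a times the coefficient of h_r(S ∪ {c}), and
-- according as α_c = 0 or α_c > 0 exactly one of ∂_a h_{r+1}(S) and x_c ∂_a h_r(S ∪ {c})
-- contributes α_a + 1 times it. The right-hand side does not depend on a, so
-- comparing the identity for a and for b gives the theorem.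
module Submission where

open import Defs
open import Data.Nat as ℕ using (ℕ; zero; suc; pred; _≤_; _∸_)
open import Data.Nat.Properties using (+-suc)
open import Data.Integer as ℤ using (ℤ; 0ℤ; 1ℤ; _+_; _-_; _*_)
open import Data.Integer.Properties using (+-identityˡ; +-identityʳ; +-assoc; *-identityˡ; *-zeroˡ)
open import Data.Integer.Tactic.RingSolver using (solve-∀)
open import Data.Fin using (Fin; zero; suc)
open import Data.Fin.Subset using (Subset; _∈_; _∉_; _∪_; ⁅_⁆)
open import Data.Fin.Subset.Properties using (x∈p∪q⁺; x∈⁅x⁆; ∪-identityʳ)
open import Data.Vec using (Vec; []; _∷_; lookup; replicate; _[_]%=_; here; there)
import Data.Vec as Vec
open import Data.Vec.Properties using (≡-dec; lookup∘updateAt; lookup∘updateAt′)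
open import Data.List using (List; []; _∷_; map; concatMap; upTo; foldr; _++_)
open import Data.List.Properties using (foldr-map; map-applyUpTo)
open import Data.Product using (_×_; _,_; proj₁; proj₂)
open import Data.Sum using (inj₁; inj₂)
open import Data.Bool using (true; false; _∧_; _∨_; if_then_else_)
open import Data.Bool.Properties using (∨-identityʳ; ∨-zeroʳ; ∧-zeroʳ)
open import Function using (_∘_; id)
open import Relation.Nullary.Decidable using (⌊_⌋; does; isYes≗does; dec-true)
open import Relation.Binary.PropositionalEquality
open ≡-Reasoning

private
  variable
    n : ℕ
    A B : Set

sum-[]%=suc : (a : Fin n) (α : Vec ℕ n) → Vec.sum (α [ a ]%= suc) ≡ suc (Vec.sum α)
sum-[]%=suc zero    (k ∷ α) = refl
sum-[]%=suc (suc a) (k ∷ α) = trans (cong (k ℕ.+_) (sum-[]%=suc a α)) (+-suc k (Vec.sum α))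

sum-[]%=pred : (c : Fin n) (α : Vec ℕ n) {m : ℕ} → lookup α c ≡ suc m →
  suc (Vec.sum (α [ c ]%= pred)) ≡ Vec.sum α
sum-[]%=pred zero    (_ ∷ α) refl = refl
sum-[]%=pred (suc c) (k ∷ α) αc≡1+m = trans (sym (+-suc k _)) (cong (k ℕ.+_) (sum-[]%=pred c α αc≡1+m))

[]%=pred-[]%=suc : (c : Fin n) (α : Vec ℕ n) {m : ℕ} → lookup α c ≡ suc m →
  (α [ c ]%= pred) [ c ]%= suc ≡ α
[]%=pred-[]%=suc zero    (_ ∷ α) refl = refl
[]%=pred-[]%=suc (suc c) (k ∷ α) αc≡1+m = cong (k ∷_) ([]%=pred-[]%=suc c α αc≡1+m)

suppIn-[]%= : (a : Fin n) (f : ℕ → ℕ) (α : Vec ℕ n) (S : Subset n) → a ∈ S →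
  suppIn (α [ a ]%= f) S ≡ suppIn α S
suppIn-[]%= zero    f (k ∷ α) (true ∷ S) here      = refl
suppIn-[]%= (suc a) f (k ∷ α) (s ∷ S)    (there a∈S) =
  cong ((s ∨ ⌊ k ℕ.≟ 0 ⌋) ∧_) (suppIn-[]%= a f α S a∈S)

suppIn-∪⁅⁆ : (c : Fin n) (α : Vec ℕ n) (S : Subset n) → lookup α c ≡ 0 →
  suppIn α (S ∪ ⁅ c ⁆) ≡ suppIn α S
suppIn-∪⁅⁆ zero    (_ ∷ α) (s ∷ S) refl rewrite ∨-zeroʳ s | ∪-identityʳ S = refl
suppIn-∪⁅⁆ (suc c) (k ∷ α) (s ∷ S) αc≡0 rewrite ∨-identityʳ s =
  cong ((s ∨ ⌊ k ℕ.≟ 0 ⌋) ∧_) (suppIn-∪⁅⁆ c α S αc≡0)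

suppIn-∉ : (c : Fin n) (α : Vec ℕ n) (S : Subset n) {m : ℕ} → c ∉ S → lookup α c ≡ suc m →
  suppIn α S ≡ false
suppIn-∉ zero    (_ ∷ α) (true ∷ S)  c∉S refl with () ← c∉S here
suppIn-∉ zero    (_ ∷ α) (false ∷ S) c∉S refl = refl
suppIn-∉ (suc c) (k ∷ α) (s ∷ S)     c∉S αc≡1+m =
  trans (cong ((s ∨ ⌊ k ℕ.≟ 0 ⌋) ∧_) (suppIn-∉ c α S (c∉S ∘ there) αc≡1+m)) (∧-zeroʳ _)

suc-≟-suc : (m k : ℕ) → ⌊ suc m ℕ.≟ suc k ⌋ ≡ ⌊ m ℕ.≟ k ⌋
suc-≟-suc m k = trans (isYes≗does (suc m ℕ.≟ suc k)) (sym (isYes≗does (m ℕ.≟ k)))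

h-suc-[]%=suc : (r : ℕ) {S : Subset n} {a : Fin n} → a ∈ S → (α : Vec ℕ n) →
  h (suc r) S (α [ a ]%= suc) ≡ h r S α
h-suc-[]%=suc r {S} {a} a∈S α
  rewrite sum-[]%=suc a α | suppIn-[]%= a suc α S a∈S | suc-≟-suc (Vec.sum α) r = refl

h-[]%=pred-[]%=suc : (r : ℕ) {S : Subset n} {a c : Fin n} → a ∈ S → c ∈ S →
  (α : Vec ℕ n) {m : ℕ} → lookup α c ≡ suc m →
  h r S ((α [ c ]%= pred) [ a ]%= suc) ≡ h r S α
h-[]%=pred-[]%=suc r {S} {a} {c} a∈S c∈S α αc≡1+m
  rewrite sum-[]%=suc a (α [ c ]%= pred) | sum-[]%=pred c α αc≡1+m
        | suppIn-[]%= a suc (α [ c ]%= pred) S a∈S | suppIn-[]%= c pred α S c∈S = refl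

h-∪⁅⁆ : (r : ℕ) (S : Subset n) (c : Fin n) (α : Vec ℕ n) → lookup α c ≡ 0 →
  h r (S ∪ ⁅ c ⁆) α ≡ h r S α
h-∪⁅⁆ r S c α αc≡0 rewrite suppIn-∪⁅⁆ c α S αc≡0 = refl

h-∉ : (r : ℕ) {S : Subset n} {c : Fin n} → c ∉ S → (α : Vec ℕ n) {m : ℕ} → lookup α c ≡ suc m →
  h r S α ≡ 0ℤ
h-∉ r {S} {c} c∉S α αc≡1+m rewrite suppIn-∉ c α S c∉S αc≡1+m | ∧-zeroʳ ⌊ Vec.sum α ℕ.≟ r ⌋ = refl

-- A foldr, so that (p *P q) α is definitionally ∑ (λ (β , γ) → p β * q γ) (splits α).
∑ : (A → ℤ) → List A → ℤ
∑ u = foldr (λ x acc → u x + acc) 0ℤ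

∑-cong : {u v : A → ℤ} → (∀ x → u x ≡ v x) → (xs : List A) → ∑ u xs ≡ ∑ v xs
∑-cong u≗v []       = refl
∑-cong u≗v (x ∷ xs) = cong₂ _+_ (u≗v x) (∑-cong u≗v xs)

∑-zero : {u : A → ℤ} → (∀ x → u x ≡ 0ℤ) → (xs : List A) → ∑ u xs ≡ 0ℤ
∑-zero u≗0 []       = refl
∑-zero u≗0 (x ∷ xs) = cong₂ _+_ (u≗0 x) (∑-zero u≗0 xs)

∑-++ : (u : A → ℤ) (xs ys : List A) → ∑ u (xs ++ ys) ≡ ∑ u xs + ∑ u ys
∑-++ u []       ys = sym (+-identityˡ _)
∑-++ u (x ∷ xs) ys = trans (cong (u x +_) (∑-++ u xs ys)) (sym (+-assoc (u x) _ _))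

∑-- : (u v : A → ℤ) (xs : List A) → ∑ (λ x → u x - v x) xs ≡ ∑ u xs - ∑ v xs
∑-- u v []       = refl
∑-- u v (x ∷ xs) = trans (cong (u x - v x +_) (∑-- u v xs)) (interchange (u x) (v x) _ _)
  where
  interchange : ∀ a b c d → (a - b) + (c - d) ≡ (a + c) - (b + d)
  interchange = solve-∀

∑-map : (u : B → ℤ) (f : A → B) (xs : List A) → ∑ u (map f xs) ≡ ∑ (u ∘ f) xs
∑-map u f = foldr-map _ f 0ℤ

∑-concatMap : (u : B → ℤ) (f : A → List B) (xs : List A) →
  ∑ u (concatMap f xs) ≡ ∑ (∑ u ∘ f) xs
∑-concatMap u f []       = refl
∑-concatMap u f (x ∷ xs) = trans (∑-++ u (f x) _) (cong (∑ u (f x) +_) (∑-concatMap u f xs))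

∑-upTo-suc : (u : ℕ → ℤ) (k : ℕ) → ∑ u (upTo (suc k)) ≡ u 0 + ∑ (u ∘ suc) (upTo k)
∑-upTo-suc u k = cong (u 0 +_) (trans (cong (∑ u) (sym (map-applyUpTo id suc k))) (∑-map u suc (upTo k)))

0P : Poly n
0P _ = 0ℤ

monomial : Vec ℕ n → Poly n
monomial δ β = if ⌊ ≡-dec ℕ._≟_ β δ ⌋ then 1ℤ else 0ℤ

1P : Poly n
1P {n} = monomial (replicate n 0)

slice : Poly (suc n) → ℕ → Poly n
slice p i β = p (i ∷ β)

slice-monomial : (d : ℕ) (δ β : Vec ℕ n) → slice (monomial (d ∷ δ)) d β ≡ monomial δ β
-- ⌊_⌋ (= isYes) only reduces on a literal answer, whereas does unfolds through ≡-dec componentwise.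
slice-monomial d δ β = cong (if_then 1ℤ else 0ℤ) (begin
  ⌊ ≡-dec ℕ._≟_ (d ∷ β) (d ∷ δ) ⌋                    ≡⟨ isYes≗does (≡-dec ℕ._≟_ (d ∷ β) (d ∷ δ)) ⟩
  does (d ℕ.≟ d) ∧ does (≡-dec ℕ._≟_ β δ)            ≡⟨ cong (_∧ does (≡-dec ℕ._≟_ β δ)) (dec-true (d ℕ.≟ d) refl) ⟩
  does (≡-dec ℕ._≟_ β δ)                            ≡⟨ isYes≗does (≡-dec ℕ._≟_ β δ) ⟨
  ⌊ ≡-dec ℕ._≟_ β δ ⌋                                ∎)

*P-∷ : (p q : Poly (suc n)) (k : ℕ) (α : Vec ℕ n) →
  (p *P q) (k ∷ α) ≡ ∑ (λ i → (slice p i *P slice q (k ∸ i)) α) (upTo (suc k))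
*P-∷ p q k α =
  trans (∑-concatMap u (λ i → map (prepend i) (splits α)) (upTo (suc k)))
        (∑-cong (λ i → ∑-map u (prepend i) (splits α)) (upTo (suc k)))
  where
  u : Vec ℕ _ × Vec ℕ _ → ℤ
  u (β , γ) = p β * q γ
  prepend : ℕ → Vec ℕ _ × Vec ℕ _ → Vec ℕ _ × Vec ℕ _
  prepend i (β , γ) = i ∷ β , (k ∸ i) ∷ γ

*P-zeroˡ : (q : Poly n) (α : Vec ℕ n) → (0P *P q) α ≡ 0ℤ
*P-zeroˡ q α = ∑-zero (λ _ → refl) (splits α)

*P-congˡ : {p p′ : Poly n} → p ≈P p′ → (q : Poly n) (α : Vec ℕ n) → (p *P q) α ≡ (p′ *P q) α
*P-congˡ p≈p′ q α = ∑-cong (λ x → cong (_* q (proj₂ x)) (p≈p′ (proj₁ x))) (splits α)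

*P-distribʳ--P : (p p′ q : Poly n) (α : Vec ℕ n) → ((p -P p′) *P q) α ≡ (p *P q) α - (p′ *P q) α
*P-distribʳ--P p p′ q α =
  trans (∑-cong (λ x → *-distribʳ-- (p (proj₁ x)) (p′ (proj₁ x)) (q (proj₂ x))) (splits α))
        (∑-- (λ x → p (proj₁ x) * q (proj₂ x)) (λ x → p′ (proj₁ x) * q (proj₂ x)) (splits α))
  where
  *-distribʳ-- : ∀ a b c → (a - b) * c ≡ a * c - b * c
  *-distribʳ-- = solve-∀

*P-∷-head : (p q : Poly (suc n)) → (∀ i → slice p (suc i) ≈P 0P) → (k : ℕ) (α : Vec ℕ n) →
  (p *P q) (k ∷ α) ≡ (slice p 0 *P slice q k) α
*P-∷-head p q tail≈0 k α = begin
  (p *P q) (k ∷ α)                                              ≡⟨ *P-∷ p q k α ⟩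
  ∑ term (upTo (suc k))                                        ≡⟨ ∑-upTo-suc term k ⟩
  term 0 + ∑ (term ∘ suc) (upTo k)                             ≡⟨ cong (term 0 +_) (∑-zero {u = term ∘ suc} tail≡0 (upTo k)) ⟩
  term 0 + 0ℤ                                                  ≡⟨ +-identityʳ (term 0) ⟩
  (slice p 0 *P slice q k) α                                   ∎
  where
  term : ℕ → ℤ
  term i = (slice p i *P slice q (k ∸ i)) α
  tail≡0 : ∀ i → term (suc i) ≡ 0ℤ
  tail≡0 i = trans (*P-congˡ (tail≈0 i) (slice q (k ∸ suc i)) α) (*P-zeroˡ (slice q (k ∸ suc i)) α)

*P-identityˡ : (q : Poly n) → 1P *P q ≈P q
*P-identityˡ q []      = trans (+-identityʳ _) (*-identityˡ (q []))
*P-identityˡ {suc n} q (k ∷ α) = begin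
  (1P *P q) (k ∷ α)                ≡⟨ *P-∷-head 1P q (λ _ _ → refl) k α ⟩
  (slice 1P 0 *P slice q k) α      ≡⟨ *P-congˡ (slice-monomial 0 (replicate n 0)) (slice q k) α ⟩
  (1P *P slice q k) α              ≡⟨ *P-identityˡ (slice q k) α ⟩
  q (k ∷ α)                        ∎

var-suc-*P-∷ : (c : Fin n) (g : Poly (suc n)) (k : ℕ) (α : Vec ℕ n) →
  (var (suc c) *P g) (k ∷ α) ≡ (var c *P slice g k) α
var-suc-*P-∷ {n} c g k α = trans (*P-∷-head (var (suc c)) g (λ _ _ → refl) k α)
  (*P-congˡ (slice-monomial 0 (replicate n 0 Vec.[ c ]≔ 1)) (slice g k) α)

var-*P-vanishes : (c : Fin n) (g : Poly n) (α : Vec ℕ n) → lookup α c ≡ 0 → (var c *P g) α ≡ 0ℤ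
var-*P-vanishes zero    g (_ ∷ α) refl =
  trans (*P-∷ (var zero) g 0 α) (trans (+-identityʳ _) (*P-zeroˡ (slice g 0) α))
var-*P-vanishes (suc c) g (k ∷ α) αc≡0 =
  trans (var-suc-*P-∷ c g k α) (var-*P-vanishes c (slice g k) α αc≡0)

var-*P-shifts : (c : Fin n) (g : Poly n) (α : Vec ℕ n) {m : ℕ} → lookup α c ≡ suc m →
  (var c *P g) α ≡ g (α [ c ]%= pred)
var-*P-shifts {suc n} zero g (suc m ∷ α) refl = begin
  (var zero *P g) (suc m ∷ α)                          ≡⟨ *P-∷ (var zero) g (suc m) α ⟩
  ∑ term (upTo (suc (suc m)))                          ≡⟨ ∑-upTo-suc term (suc m) ⟩
  term 0 + ∑ (term ∘ suc) (upTo (suc m))               ≡⟨ cong₂ _+_ (*P-zeroˡ (slice g (suc m)) α) (∑-upTo-suc (term ∘ suc) m) ⟩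
  0ℤ + (term 1 + ∑ ((term ∘ suc) ∘ suc) (upTo m))      ≡⟨ cong (λ s → 0ℤ + (term 1 + s)) (∑-zero {u = (term ∘ suc) ∘ suc} tail≡0 (upTo m)) ⟩
  0ℤ + (term 1 + 0ℤ)                                   ≡⟨ trans (+-identityˡ _) (+-identityʳ (term 1)) ⟩
  term 1                                               ≡⟨ *P-congˡ (slice-monomial 1 (replicate n 0)) (slice g m) α ⟩
  (1P *P slice g m) α                                  ≡⟨ *P-identityˡ (slice g m) α ⟩
  g (m ∷ α)                                            ∎
  where
  term : ℕ → ℤ
  term i = (slice (var zero) i *P slice g (suc m ∸ i)) α
  tail≡0 : ∀ i → term (suc (suc i)) ≡ 0ℤ
  tail≡0 i = *P-zeroˡ (slice g (m ∸ suc i)) α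
var-*P-shifts (suc c) g (k ∷ α) αc≡1+m =
  trans (var-suc-*P-∷ c g k α) (var-*P-shifts c (slice g k) α αc≡1+m)

var-*P-∂ : (a : Fin n) (p : Poly n) (α : Vec ℕ n) → (var a *P ∂ a p) α ≡ ℤ.+ lookup α a * p α
var-*P-∂ a p α with lookup α a in αa≡k
... | zero  = trans (var-*P-vanishes a (∂ a p) α αa≡k) (sym (*-zeroˡ (p α)))
... | suc m = begin
  (var a *P ∂ a p) α                                                          ≡⟨ var-*P-shifts a (∂ a p) α αa≡k ⟩
  ℤ.+ suc (lookup (α [ a ]%= pred) a) * p ((α [ a ]%= pred) [ a ]%= suc)      ≡⟨ cong₂ (λ k β → ℤ.+ suc k * p β)
                                                                                   (trans (lookup∘updateAt a α) (cong pred αa≡k))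
                                                                                   ([]%=pred-[]%=suc a α αa≡k) ⟩
  ℤ.+ suc m * p α                                                             ∎

∂h-recurrence : (r : ℕ) {S : Subset n} {a c : Fin n} → a ∈ S → c ∉ S →
  ∂ a (h (suc r) S) +P (var c -P var a) *P ∂ a (h r (S ∪ ⁅ c ⁆)) ≈P h r (S ∪ ⁅ c ⁆)
∂h-recurrence r {S} {a} {c} a∈S c∉S α = begin
  ∂ a (h (suc r) S) α + ((var c -P var a) *P ∂ a H) α
    ≡⟨ cong₂ _+_ (cong (ℤ.+ suc αₐ *_) (h-suc-[]%=suc r a∈S α)) (*P-distribʳ--P (var c) (var a) (∂ a H) α) ⟩
  ℤ.+ suc αₐ * h r S α + ((var c *P ∂ a H) α - (var a *P ∂ a H) α)
    ≡⟨ cong (λ t → ℤ.+ suc αₐ * h r S α + ((var c *P ∂ a H) α - t)) (var-*P-∂ a H α) ⟩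
  ℤ.+ suc αₐ * h r S α + ((var c *P ∂ a H) α - ℤ.+ αₐ * H α)
    ≡⟨ by-cases (lookup α c) refl ⟩
  H α ∎
  where
  H : Poly _
  H = h r (S ∪ ⁅ c ⁆)
  αₐ : ℕ
  αₐ = lookup α a
  a∈S∪c : a ∈ S ∪ ⁅ c ⁆
  a∈S∪c = x∈p∪q⁺ (inj₁ a∈S)
  c∈S∪c : c ∈ S ∪ ⁅ c ⁆
  c∈S∪c = x∈p∪q⁺ {p = S} (inj₂ (x∈⁅x⁆ c))
  a≢c : a ≢ c
  a≢c refl = c∉S a∈S
  -- ℤ.+ suc k is definitionally 1ℤ + ℤ.+ k.
  cancel₁ : ∀ x y → (1ℤ + x) * y + (0ℤ - x * y) ≡ y
  cancel₁ = solve-∀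
  cancel₂ : ∀ x y → (1ℤ + x) * 0ℤ + ((1ℤ + x) * y - x * y) ≡ y
  cancel₂ = solve-∀
  by-cases : ∀ k → lookup α c ≡ k →
    ℤ.+ suc αₐ * h r S α + ((var c *P ∂ a H) α - ℤ.+ αₐ * H α) ≡ H α
  by-cases zero αc≡0 = trans
    (cong₂ (λ s t → ℤ.+ suc αₐ * s + (t - ℤ.+ αₐ * H α))
           (sym (h-∪⁅⁆ r S c α αc≡0)) (var-*P-vanishes c (∂ a H) α αc≡0))
    (cancel₁ (ℤ.+ αₐ) (H α))
  by-cases (suc m) αc≡1+m = trans
    (cong₂ (λ s t → ℤ.+ suc αₐ * s + (t - ℤ.+ αₐ * H α))
           (h-∉ r c∉S α αc≡1+m)
           (trans (var-*P-shifts c (∂ a H) α αc≡1+m)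
                  (cong₂ (λ k v → ℤ.+ suc k * v) (lookup∘updateAt′ a c a≢c α)
                         (h-[]%=pred-[]%=suc r a∈S∪c c∈S∪c α αc≡1+m))))
    (cancel₂ (ℤ.+ αₐ) (H α))

lemma3p3 : (n : ℕ) (S : Subset n) (a b c : Fin n) → a ∈ S → b ∈ S → c ∉ S →
    (r : ℕ) → 2 ≤ r →
    ∂ a (h r S) ≈P ∂ b (h r S) +P (var c -P var b) *P ∂ b (h (r ∸ 1) (S ∪ ⁅ c ⁆))
                     -P (var c -P var a) *P ∂ a (h (r ∸ 1) (S ∪ ⁅ c ⁆))
lemma3p3 n S a b c a∈S b∈S c∉S (suc r) _ α = begin
  ∂ a (h (suc r) S) α                  ≡⟨ add-sub (∂ a (h (suc r) S) α) (Δₐ α) ⟩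
  ∂ a (h (suc r) S) α + Δₐ α - Δₐ α    ≡⟨ cong (_- Δₐ α) (∂h-recurrence r a∈S c∉S α) ⟩
  h r (S ∪ ⁅ c ⁆) α - Δₐ α             ≡⟨ cong (_- Δₐ α) (∂h-recurrence r b∈S c∉S α) ⟨
  ∂ b (h (suc r) S) α + Δᵦ α - Δₐ α    ∎
  where
  Δₐ Δᵦ : Poly n
  Δₐ = (var c -P var a) *P ∂ a (h r (S ∪ ⁅ c ⁆))
  Δᵦ = (var c -P var b) *P ∂ b (h r (S ∪ ⁅ c ⁆))
  add-sub : ∀ x y → x ≡ x + y - y
  add-sub = solve-∀
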